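{- Let $R$ be a finite commutative ring with unity with $R\cong R_1\times R_2\times\cdots\times R_n$, where $n\ge 2$ and each $R_i$ is a local ring. Then $G_{\mathrm{Id}}(R)$ is a cograph if and only if one of the following holds: (i) $\mathrm{char}(R_i)=2$ for each $i$; (ii) $R\cong \mathbb{Z}_3\times R_2\times R_3\times\cdots\times R_n$ with $\mathrm{char}(R_i)=2$ for $2\le i\le n$.
   Context: For a ring $S$ with unity, an element $x\in S$ is idempotent if $x^2=x$; $\mathrm{Id}(S)$ denotes the set of idempotents of $S$. The idempotent graph $G_{\mathrm{Id}}(S)$ is the simple undirected graph with vertex set $S$ in which two distinct vertices $x,y$ are adjacent if and only if $x+y\in \mathrm{Id}(S)$. A ring is local if it has a unique maximal ideal. $\mathrm{char}(S)$ is the least positive integer $m$ with $m\cdot 1=0$. A cograph is a graph with no induced subgraph isomorphic to the path $P_4$ on four vertices. -}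

module Defs where

open import Level using (Level; _⊔_; 0ℓ)
open import Data.Nat using (ℕ; zero; suc; _<_) renaming (_*_ to _*ℕ_; _+_ to _+ℕ_)
open import Data.Sum using (_⊎_)
open import Data.Nat.DivMod using (_mod_)
open import Data.Fin using (Fin; toℕ)
open import Data.Product using (Σ; ∃; _×_; _,_)
open import Relation.Nullary using (¬_)
open import Relation.Unary using (Pred)
open import Relation.Binary.PropositionalEquality using (_≡_)
import Relation.Binary.PropositionalEquality as ≡
open import Function.Bundles using (Inverse)
open import Algebra.Bundles using (CommutativeRing)
open import Algebra.Bundles.Raw using (RawRing)
import Algebra.Definitions.RawSemiring as RawSemiringDefs

Finite : ∀ {c ℓ} → CommutativeRing c ℓ → Set (c ⊔ ℓ)
Finite R = ∃ λ k → Inverse (≡.setoid (Fin k)) (CommutativeRing.setoid R)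

module _ {c ℓ} (R : CommutativeRing c ℓ) where
  open CommutativeRing R

  record Ideal : Set (Level.suc (c ⊔ ℓ)) where
    field
      mem      : Pred Carrier (c ⊔ ℓ)
      resp     : ∀ {x y} → x ≈ y → mem x → mem y
      has-0    : mem 0#
      +-closed : ∀ {x y} → mem x → mem y → mem (x + y)
      *-closed : ∀ r {x} → mem x → mem (r * x)

  open Ideal public

  _⊆I_ : Ideal → Ideal → Set (c ⊔ ℓ)
  I ⊆I J = ∀ x → mem I x → mem J x

  _≐I_ : Ideal → Ideal → Set (c ⊔ ℓ)
  I ≐I J = (I ⊆I J) × (J ⊆I I)

  Proper : Ideal → Set (c ⊔ ℓ)
  Proper I = ¬ (∀ x → mem I x)

  IsMaximal : Ideal → Set (Level.suc (c ⊔ ℓ))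
  IsMaximal M = Proper M × (∀ J → M ⊆I J → (J ≐I M) ⊎ (∀ x → mem J x))

  IsLocal : Set (Level.suc (c ⊔ ℓ))
  IsLocal = Σ Ideal λ M → IsMaximal M × (∀ M′ → IsMaximal M′ → M′ ≐I M)

  open RawSemiringDefs (RawRing.rawSemiring rawRing) using () renaming (_×_ to _·ℕ_)

  HasChar : ℕ → Set ℓ
  HasChar m = (0 < m) × ((m ·ℕ 1#) ≈ 0#)
            × (∀ k → 0 < k → k < m → ¬ ((k ·ℕ 1#) ≈ 0#))

  IsIdempotent : Carrier → Set ℓ
  IsIdempotent e = (e * e) ≈ e

  IdAdj : Carrier → Carrier → Set ℓ
  IdAdj x y = (¬ (x ≈ y)) × IsIdempotent (x + y)

-- Cographs: a simple graph (vertex setoid equality _≈_, adjacency _~_) is a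
-- cograph iff it has no induced subgraph isomorphic to P₄, i.e. there are no
-- four pairwise distinct vertices a - b - c - d forming an induced path.

module _ {v ℓ e} {V : Set v} (_≈_ : V → V → Set ℓ) (_~_ : V → V → Set e) where

  InducedP4 : V → V → V → V → Set (ℓ ⊔ e)
  InducedP4 a b c d =
      ¬ (a ≈ b) × ¬ (a ≈ c) × ¬ (a ≈ d) × ¬ (b ≈ c) × ¬ (b ≈ d) × ¬ (c ≈ d)
    × (a ~ b) × (b ~ c) × (c ~ d)
    × ¬ (a ~ c) × ¬ (b ~ d) × ¬ (a ~ d)

  IsCograph : Set (v ⊔ ℓ ⊔ e)
  IsCograph = ∀ a b c d → ¬ InducedP4 a b c d

IdempotentGraphIsCograph : ∀ {c ℓ} → CommutativeRing c ℓ → Set (c ⊔ ℓ)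
IdempotentGraphIsCograph R =
  IsCograph (CommutativeRing._≈_ R) (IdAdj R)

ΠRaw : ∀ {c ℓ} (n : ℕ) → (Fin n → CommutativeRing c ℓ) → RawRing c ℓ
ΠRaw n Rs = record
  { Carrier = (i : Fin n) → CommutativeRing.Carrier (Rs i)
  ; _≈_     = λ f g → ∀ i → CommutativeRing._≈_ (Rs i) (f i) (g i)
  ; _+_     = λ f g i → CommutativeRing._+_ (Rs i) (f i) (g i)
  ; _*_     = λ f g i → CommutativeRing._*_ (Rs i) (f i) (g i)
  ; -_      = λ f i → CommutativeRing.-_ (Rs i) (f i)
  ; 0#      = λ i → CommutativeRing.0# (Rs i)
  ; 1#      = λ i → CommutativeRing.1# (Rs i)
  }

ℤ₃ : RawRing 0ℓ 0ℓ
ℤ₃ = record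
  { Carrier = Fin 3
  ; _≈_     = _≡_
  ; _+_     = λ a b → (toℕ a +ℕ toℕ b) mod 3
  ; _*_     = λ a b → (toℕ a *ℕ toℕ b) mod 3
  ; -_      = λ a → (2 *ℕ toℕ a) mod 3
  ; 0#      = 0 mod 3
  ; 1#      = 1 mod 3
  }

open import Algebra.Morphism.Structures using (IsRingIsomorphism)

_≅ʳ_ : ∀ {a b ℓ₁ ℓ₂} → RawRing a ℓ₁ → RawRing b ℓ₂ → Set (a ⊔ b ⊔ ℓ₁ ⊔ ℓ₂)
A ≅ʳ B = Σ (RawRing.Carrier A → RawRing.Carrier B) (IsRingIsomorphism A B)

-- A path a – b – c – d in G_Id(R) is induced exactly when a + b, b + c, c + d are
-- idempotent and a + c, b + d, a + d are not, and idempotency in R ≅ ∏ Rᵢ is checked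
-- coordinatewise. If 2 = 0, idempotents are closed under addition, so a + c is
-- idempotent in that coordinate; in ℤ₃ a finite check shows that one of a + c, b + d,
-- a + d is idempotent. As only one coordinate is ℤ₃, no induced P₄ survives. Conversely,
-- a finite local ring has only the idempotents 0 and 1. If two factors have 2 ≠ 0, then
-- (1,1), (0,0), (0,1), (1,−1) span an induced P₄. If only Rⱼ has 2 ≠ 0, then 0, 1, −1, 2
-- span one unless 3 = 0, and x, −x, 1 + x, −(1 + x) span one unless x ∈ {0, 1, −1};
-- hence Rⱼ ≅ ℤ₃. These case distinctions are classical; they are available because a
-- maximal ideal of a factor, in the sense used here, decides every proposition.
module Submission where

open import Defs
open import Level using (_⊔_; Lift; lift; lower)
open import Data.Bool.Properties using (T-≡)
open import Data.Empty using (⊥-elim)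
open import Data.Fin using (Fin; toℕ; punchIn)
open import Data.Fin.Patterns using (0F; 1F; 2F)
open import Data.Fin.Properties using (_≟_; all?; ¬∀⟶∃¬; punchInᵢ≢i)
open import Data.Fin.Subset using (Subset; _∈_; _⊂_; ∣_∣)
open import Data.Fin.Subset.Properties using (p⊂q⇒∣p∣<∣q∣; ∣p∣≤n)
open import Data.Maybe using (nothing)
open import Data.Nat using (ℕ; zero; suc; _≤_; _<_; _∸_; z≤n; s≤s)
import Data.Nat as ℕ
open import Data.Nat.DivMod using (_mod_; _/_; _divMod_; DivMod)
open import Data.Nat.Properties using (≤-refl; ≤-trans; ≤-pred; n≮0; ∸-monoʳ-<)
open import Data.Product using (Σ; ∃; ∃₂; _×_; _,_; proj₁; proj₂)
open import Data.Sum using (_⊎_; inj₁; inj₂; [_,_]; map; map₁)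
open import Data.Vec using (tabulate)
open import Data.Vec.Properties using (lookup∘tabulate; []=⇒lookup; lookup⇒[]=)
open import Function using (_∘_; id)
open import Function.Bundles using (_⇔_; mk⇔; Equivalence; Surjection)
import Function.Construct.Composition as Compose
open import Function.Properties.Equivalence using () renaming (sym to ⇔-sym; trans to ⇔-trans)
open import Function.Properties.Inverse using (Inverse⇒Surjection)
open import Relation.Nullary using (¬_; Dec; yes; no)
open import Relation.Nullary.Decidable
  using (from-yes; _→-dec_; _⊎-dec_; map′; isYes; isYes≗does; decidable-stable; toWitness; dec-true)
open import Relation.Binary.PropositionalEquality using (_≡_; _≢_; subst)
import Relation.Binary.PropositionalEquality as ≡
open import Algebra.Bundles using (CommutativeRing)
open import Algebra.Bundles.Raw using (RawRing)
import Algebra.Construct.DirectProduct as DirectProduct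
open import Algebra.Morphism.Structures using (IsRingIsomorphism)
open import Tactic.RingSolver using (solve-∀)
open import Tactic.RingSolver.Core.AlmostCommutativeRing using (AlmostCommutativeRing; fromCommutativeRing)

module Identities {c ℓ} (S : CommutativeRing c ℓ) where
  ring : AlmostCommutativeRing c ℓ
  ring = fromCommutativeRing S (λ _ → nothing)
  open AlmostCommutativeRing ring

  square-+ : ∀ x y → (x + y) * (x + y) ≈ (x * x + y * y) + (x * y + x * y)
  square-+ = solve-∀ ring

  +-telescope : ∀ x y z → (x + y) + (y + z) ≈ (x + z) + (y + y)
  +-telescope = solve-∀ ring

  +-linear : ∀ y a r a′ r′ → (a + y * r) + (a′ + y * r′) ≈ (a + a′) + y * (r + r′)
  +-linear = solve-∀ ring

  *-linear : ∀ y s a r → s * (a + y * r) ≈ s * a + y * (s * r)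
  *-linear = solve-∀ ring

  *-swap : ∀ y s r → s * (y * r) ≈ y * (s * r)
  *-swap = solve-∀ ring

-- Idempotent sums

module _ {c ℓ} (S : CommutativeRing c ℓ) where
  open CommutativeRing S
  open import Algebra.Properties.Ring ring using (x+x≈x⇒x≈0; -1*x≈-x; -‿involutive; -‿anti-homo-+)
  open import Relation.Binary.Reasoning.Setoid setoid
  open Identities S using (square-+; +-telescope)

  two : Carrier
  two = 1# + 1#

  idempotent-resp : ∀ {x y} → x ≈ y → IsIdempotent S x → IsIdempotent S y
  idempotent-resp {x} {y} x≈y xx≈x = begin
    y * y  ≈⟨ *-cong x≈y x≈y ⟨
    x * x  ≈⟨ xx≈x ⟩
    x      ≈⟨ x≈y ⟩
    y      ∎

  ≈0⇒idempotent : ∀ {x} → x ≈ 0# → IsIdempotent S x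
  ≈0⇒idempotent x≈0 = idempotent-resp (sym x≈0) (zeroˡ 0#)

  ≈1⇒idempotent : ∀ {x} → x ≈ 1# → IsIdempotent S x
  ≈1⇒idempotent x≈1 = idempotent-resp (sym x≈1) (*-identityˡ 1#)

  idempotent[two]⇒two≈0 : IsIdempotent S two → two ≈ 0#
  idempotent[two]⇒two≈0 idem = x+x≈x⇒x≈0 two (begin
    two + two            ≈⟨ +-cong (*-identityʳ two) (*-identityʳ two) ⟨
    two * 1# + two * 1#  ≈⟨ distribˡ two 1# 1# ⟨
    two * two            ≈⟨ idem ⟩
    two                  ∎)

  idempotent[-1]⇒two≈0 : IsIdempotent S (- 1#) → two ≈ 0#
  idempotent[-1]⇒two≈0 idem = begin
    1# + 1#      ≈⟨ +-congˡ 1≈-1 ⟩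
    1# - 1#      ≈⟨ -‿inverseʳ 1# ⟩
    0#           ∎
    where
    1≈-1 : 1# ≈ - 1#
    1≈-1 = begin
      1#             ≈⟨ -‿involutive 1# ⟨
      - - 1#         ≈⟨ -1*x≈-x (- 1#) ⟨
      - 1# * - 1#    ≈⟨ idem ⟩
      - 1#           ∎

  -x+[1+x]≈1 : ∀ x → - x + (1# + x) ≈ 1#
  -x+[1+x]≈1 x = begin
    - x + (1# + x)  ≈⟨ +-congˡ (+-comm 1# x) ⟩
    - x + (x + 1#)  ≈⟨ +-assoc (- x) x 1# ⟨
    (- x + x) + 1#  ≈⟨ +-congʳ (-‿inverseˡ x) ⟩
    0# + 1#         ≈⟨ +-identityˡ 1# ⟩
    1#              ∎

  x-[1+x]≈-1 : ∀ x → x - (1# + x) ≈ - 1#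
  x-[1+x]≈-1 x = begin
    x - (1# + x)       ≈⟨ +-congˡ (-‿anti-homo-+ 1# x) ⟩
    x + (- x + - 1#)   ≈⟨ +-assoc x (- x) (- 1#) ⟨
    (x - x) + - 1#     ≈⟨ +-congʳ (-‿inverseʳ x) ⟩
    0# + - 1#          ≈⟨ +-identityˡ (- 1#) ⟩
    - 1#               ∎

  module _ (two≈0 : two ≈ 0#) where

    two≈0⇒x+x≈0 : ∀ x → x + x ≈ 0#
    two≈0⇒x+x≈0 x = begin
      x + x            ≈⟨ +-cong (*-identityˡ x) (*-identityˡ x) ⟨
      1# * x + 1# * x  ≈⟨ distribʳ x 1# 1# ⟨
      two * x          ≈⟨ *-congʳ two≈0 ⟩
      0# * x           ≈⟨ zeroˡ x ⟩
      0#               ∎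

    two≈0⇒idempotent-+ : ∀ {e f} → IsIdempotent S e → IsIdempotent S f → IsIdempotent S (e + f)
    two≈0⇒idempotent-+ {e} {f} ee≈e ff≈f = begin
      (e + f) * (e + f)                  ≈⟨ square-+ e f ⟩
      (e * e + f * f) + (e * f + e * f)  ≈⟨ +-cong (+-cong ee≈e ff≈f) (two≈0⇒x+x≈0 (e * f)) ⟩
      (e + f) + 0#                       ≈⟨ +-identityʳ (e + f) ⟩
      e + f                              ∎

    two≈0⇒idempotent-sum-trans : ∀ {x y z} → IsIdempotent S (x + y) → IsIdempotent S (y + z)
                               → IsIdempotent S (x + z)
    two≈0⇒idempotent-sum-trans {x} {y} {z} xy yz = idempotent-resp (begin
      (x + y) + (y + z)  ≈⟨ +-telescope x y z ⟩
      (x + z) + (y + y)  ≈⟨ +-congˡ (two≈0⇒x+x≈0 y) ⟩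
      (x + z) + 0#       ≈⟨ +-identityʳ (x + z) ⟩
      x + z              ∎) (two≈0⇒idempotent-+ xy yz)

  SumP4 : Carrier → Carrier → Carrier → Carrier → Set ℓ
  SumP4 a b c d = IsIdempotent S (a + b) × IsIdempotent S (b + c) × IsIdempotent S (c + d)
                × ¬ IsIdempotent S (a + c) × ¬ IsIdempotent S (b + d) × ¬ IsIdempotent S (a + d)

  SumP4-Free : Set (c ⊔ ℓ)
  SumP4-Free = ∀ a b c d → ¬ SumP4 a b c d

  HasSumChords : Set (c ⊔ ℓ)
  HasSumChords = ∀ {a b c d} → IsIdempotent S (a + b) → IsIdempotent S (b + c) → IsIdempotent S (c + d)
               → IsIdempotent S (a + c) ⊎ IsIdempotent S (b + d) ⊎ IsIdempotent S (a + d)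

  -- Equal vertices would make one of the three idempotent sums coincide with one of the
  -- three non-idempotent ones.
  sumP4⇒inducedP4 : ∀ {a b c d} → SumP4 a b c d → InducedP4 _≈_ (IdAdj S) a b c d
  sumP4⇒inducedP4 {a} {b} {c} {d} (ab , bc , cd , ¬ac , ¬bd , ¬ad) =
    a≉b , a≉c , a≉d , b≉c , b≉d , c≉d , (a≉b , ab) , (b≉c , bc) , (c≉d , cd)
    , ¬ac ∘ proj₂ , ¬bd ∘ proj₂ , ¬ad ∘ proj₂
    where
    a≉b : ¬ a ≈ b
    a≉b a≈b = ¬ac (idempotent-resp (+-congʳ (sym a≈b)) bc)
    a≉c : ¬ a ≈ c
    a≉c a≈c = ¬ad (idempotent-resp (+-congʳ (sym a≈c)) cd)
    a≉d : ¬ a ≈ d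
    a≉d a≈d = ¬ac (idempotent-resp (trans (+-comm c d) (+-congʳ (sym a≈d))) cd)
    b≉c : ¬ b ≈ c
    b≉c b≈c = ¬bd (idempotent-resp (+-congʳ (sym b≈c)) cd)
    b≉d : ¬ b ≈ d
    b≉d b≈d = ¬ad (idempotent-resp (+-congˡ b≈d) ab)
    c≉d : ¬ c ≈ d
    c≉d c≈d = ¬bd (idempotent-resp (+-congˡ c≈d) bc)

  inducedP4⇒sumP4 : ∀ {a b c d} → InducedP4 _≈_ (IdAdj S) a b c d → SumP4 a b c d
  inducedP4⇒sumP4 (_ , a≉c , a≉d , _ , b≉d , _ , (_ , ab) , (_ , bc) , (_ , cd) , ¬a~c , ¬b~d , ¬a~d) =
    ab , bc , cd , (λ ac → ¬a~c (a≉c , ac)) , (λ bd → ¬b~d (b≉d , bd)) , (λ ad → ¬a~d (a≉d , ad))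

  cograph⇔sumP4-free : IdempotentGraphIsCograph S ⇔ SumP4-Free
  cograph⇔sumP4-free = mk⇔
    (λ cograph a b c d → cograph a b c d ∘ sumP4⇒inducedP4)
    (λ free a b c d → free a b c d ∘ inducedP4⇒sumP4)

module _ {a ℓa b ℓb} (A : CommutativeRing a ℓa) (B : CommutativeRing b ℓb) where
  private
    module A = CommutativeRing A
    module B = CommutativeRing B

  sumP4-free-comap : (h : A.Carrier → B.Carrier)
                   → (∀ x y → IsIdempotent A (x A.+ y) ⇔ IsIdempotent B (h x B.+ h y))
                   → SumP4-Free B → SumP4-Free A
  sumP4-free-comap h idem⇔ free x y z w (xy , yz , zw , ¬xz , ¬yw , ¬xw) =
    free (h x) (h y) (h z) (h w) (to xy , to yz , to zw , ¬xz ∘ from , ¬yw ∘ from , ¬xw ∘ from)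
    where
    to : ∀ {u v} → IsIdempotent A (u A.+ v) → IsIdempotent B (h u B.+ h v)
    to = Equivalence.to (idem⇔ _ _)
    from : ∀ {u v} → IsIdempotent B (h u B.+ h v) → IsIdempotent A (u A.+ v)
    from = Equivalence.from (idem⇔ _ _)

  module _ {f : A.Carrier → B.Carrier} (isIso : IsRingIsomorphism A.rawRing B.rawRing f) where
    open IsRingIsomorphism isIso

    idempotent⇔idempotent-image : ∀ z → IsIdempotent A z ⇔ IsIdempotent B (f z)
    idempotent⇔idempotent-image z = mk⇔
      (λ zz≈z → B.trans (B.sym (*-homo z z)) (⟦⟧-cong zz≈z))
      (λ fz² → injective (B.trans (*-homo z z) fz²))

    idempotent-sum⇔ : ∀ {x y u v} → f x B.≈ u → f y B.≈ v
                    → IsIdempotent A (x A.+ y) ⇔ IsIdempotent B (u B.+ v)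
    idempotent-sum⇔ {x} {y} {u} {v} fx≈u fy≈v = mk⇔
      (idempotent-resp B f[x+y]≈u+v ∘ Equivalence.to (idempotent⇔idempotent-image (x A.+ y)))
      (Equivalence.from (idempotent⇔idempotent-image (x A.+ y)) ∘ idempotent-resp B (B.sym f[x+y]≈u+v))
      where
      f[x+y]≈u+v : f (x A.+ y) B.≈ u B.+ v
      f[x+y]≈u+v = B.trans (+-homo x y) (B.+-cong fx≈u fy≈v)

  ≅ʳ⇒surjection : A.rawRing ≅ʳ B.rawRing → Surjection A.setoid B.setoid
  ≅ʳ⇒surjection (f , isIso) = record { to = f ; cong = ⟦⟧-cong ; surjective = surjective }
    where open IsRingIsomorphism isIso

module _ {a ℓa b ℓb} (A : CommutativeRing a ℓa) (B : CommutativeRing b ℓb) where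
  private
    module A = CommutativeRing A
    module B = CommutativeRing B

  ≅ʳ⇒sumP4-free⇔ : A.rawRing ≅ʳ B.rawRing → SumP4-Free A ⇔ SumP4-Free B
  ≅ʳ⇒sumP4-free⇔ (f , isIso) = mk⇔
    (sumP4-free-comap B A section λ u v → ⇔-sym (idempotent-sum⇔ A B isIso (f∘section u) (f∘section v)))
    (sumP4-free-comap A B f λ _ _ → idempotent-sum⇔ A B isIso B.refl B.refl)
    where
    open IsRingIsomorphism isIso using (surjective)
    section : B.Carrier → A.Carrier
    section u = proj₁ (surjective u)
    f∘section : ∀ u → f (section u) B.≈ u
    f∘section u = proj₂ (surjective u) A.refl

-- Direct products

module _ {c ℓ} (S T : CommutativeRing c ℓ) where
  private
    module S = CommutativeRing S
    module T = CommutativeRing T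
    S×T = DirectProduct.commutativeRing S T

  sumP4-free-×⇒sumP4-free₂ : SumP4-Free S×T → SumP4-Free T
  sumP4-free-×⇒sumP4-free₂ = sumP4-free-comap T S×T (S.0# ,_) λ _ _ →
    mk⇔ (≈0⇒idempotent S (S.+-identityʳ S.0#) ,_) proj₂

  two≉0⇒¬sumP4-free-× : ¬ two S S.≈ S.0# → ¬ two T T.≈ T.0# → ¬ SumP4-Free S×T
  two≉0⇒¬sumP4-free-× two≉0ˢ two≉0ᵗ free =
    free (S.1# , T.1#) (S.0# , T.0#) (S.0# , T.1#) (S.1# , T.- T.1#)
      ( (≈1⇒idempotent S (S.+-identityʳ S.1#) , ≈1⇒idempotent T (T.+-identityʳ T.1#))
      , (≈0⇒idempotent S (S.+-identityʳ S.0#) , ≈1⇒idempotent T (T.+-identityˡ T.1#))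
      , (≈1⇒idempotent S (S.+-identityˡ S.1#) , ≈0⇒idempotent T (T.-‿inverseʳ T.1#))
      , two≉0ᵗ ∘ idempotent[two]⇒two≈0 T ∘ proj₂
      , two≉0ᵗ ∘ idempotent[-1]⇒two≈0 T ∘ idempotent-resp T (T.+-identityˡ (T.- T.1#)) ∘ proj₂
      , two≉0ˢ ∘ idempotent[two]⇒two≈0 S ∘ proj₁ )

module _ {c ℓ} {n : ℕ} (Rs : Fin n → CommutativeRing c ℓ) where
  private
    module R (i : Fin n) = CommutativeRing (Rs i)

  ΠRing : CommutativeRing c ℓ
  ΠRing = record
    { RawRing (ΠRaw n Rs)
    ; isCommutativeRing = record
      { isRing = record
        { +-isAbelianGroup = record
          { isGroup = record
            { isMonoid = record
              { isSemigroup = record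
                { isMagma = record
                  { isEquivalence = record
                    { refl  = λ i → R.refl i
                    ; sym   = λ x≈y i → R.sym i (x≈y i)
                    ; trans = λ x≈y y≈z i → R.trans i (x≈y i) (y≈z i)
                    }
                  ; ∙-cong = λ x≈y u≈v i → R.+-cong i (x≈y i) (u≈v i)
                  }
                ; assoc = λ x y z i → R.+-assoc i (x i) (y i) (z i)
                }
              ; identity = (λ x i → R.+-identityˡ i (x i)) , (λ x i → R.+-identityʳ i (x i))
              }
            ; inverse = (λ x i → R.-‿inverseˡ i (x i)) , (λ x i → R.-‿inverseʳ i (x i))
            ; ⁻¹-cong = λ x≈y i → R.-‿cong i (x≈y i)
            }
          ; comm = λ x y i → R.+-comm i (x i) (y i)
          }
        ; *-cong     = λ x≈y u≈v i → R.*-cong i (x≈y i) (u≈v i)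
        ; *-assoc    = λ x y z i → R.*-assoc i (x i) (y i) (z i)
        ; *-identity = (λ x i → R.*-identityˡ i (x i)) , (λ x i → R.*-identityʳ i (x i))
        ; distrib    = (λ x y z i → R.distribˡ i (x i) (y i) (z i)) , (λ x y z i → R.distribʳ i (x i) (y i) (z i))
        }
      ; *-comm = λ x y i → R.*-comm i (x i) (y i)
      }
    }

  private
    module Π = CommutativeRing ΠRing

  single : (j : Fin n) → R.Carrier j → Π.Carrier
  single j x i with i ≟ j
  ... | yes ≡.refl = x
  ... | no _       = R.0# i

  single-at : ∀ j x → single j x j ≡ x
  single-at j x with j ≟ j
  ... | yes ≡.refl = ≡.refl
  ... | no j≢j     = ⊥-elim (j≢j ≡.refl)

  coordinate-surjection : (j : Fin n) → Surjection Π.setoid (R.setoid j)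
  coordinate-surjection j = record
    { to         = λ u → u j
    ; cong       = λ u≈v → u≈v j
    ; surjective = λ x → single j x , λ u≈single → R.trans j (u≈single j) (R.reflexive j (single-at j x))
    }

  pair : (i j : Fin n) → R.Carrier i × R.Carrier j → Π.Carrier
  pair i j (x , y) l with l ≟ i | l ≟ j
  ... | yes ≡.refl | _          = x
  ... | no _       | yes ≡.refl = y
  ... | no _       | no _       = R.0# l

  module _ {i j : Fin n} (i≢j : i ≢ j) where
    private
      Rᵢ×Rⱼ = DirectProduct.commutativeRing (Rs i) (Rs j)
      module Rᵢ×Rⱼ = CommutativeRing Rᵢ×Rⱼ

    pair-at-i : ∀ z → pair i j z i ≡ proj₁ z
    pair-at-i z with i ≟ i
    ... | yes ≡.refl = ≡.refl
    ... | no i≢i     = ⊥-elim (i≢i ≡.refl)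

    pair-at-j : ∀ z → pair i j z j ≡ proj₂ z
    pair-at-j z with j ≟ i | j ≟ j
    ... | yes ≡.refl | _          = ⊥-elim (i≢j ≡.refl)
    ... | no _       | yes ≡.refl = ≡.refl
    ... | no _       | no j≢j     = ⊥-elim (j≢j ≡.refl)

    pair-+ : ∀ z w → pair i j z Π.+ pair i j w Π.≈ pair i j (z Rᵢ×Rⱼ.+ w)
    pair-+ z w l with l ≟ i | l ≟ j
    ... | yes ≡.refl | _          = R.refl l
    ... | no _       | yes ≡.refl = R.refl l
    ... | no _       | no _       = R.+-identityˡ l (R.0# l)

    idempotent⇔idempotent-pair : ∀ z → IsIdempotent Rᵢ×Rⱼ z ⇔ IsIdempotent ΠRing (pair i j z)
    idempotent⇔idempotent-pair z = mk⇔ to from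
      where
      to : IsIdempotent Rᵢ×Rⱼ z → IsIdempotent ΠRing (pair i j z)
      to (x² , y²) l with l ≟ i | l ≟ j
      ... | yes ≡.refl | _          = x²
      ... | no _       | yes ≡.refl = y²
      ... | no _       | no _       = ≈0⇒idempotent (Rs l) (R.refl l)
      from : IsIdempotent ΠRing (pair i j z) → IsIdempotent Rᵢ×Rⱼ z
      from pz² = subst (IsIdempotent (Rs i)) (pair-at-i z) (pz² i)
               , subst (IsIdempotent (Rs j)) (pair-at-j z) (pz² j)

    sumP4-free-Π⇒sumP4-free-× : SumP4-Free ΠRing → SumP4-Free Rᵢ×Rⱼ
    sumP4-free-Π⇒sumP4-free-× = sumP4-free-comap Rᵢ×Rⱼ ΠRing (pair i j) λ z w →
      ⇔-trans (idempotent⇔idempotent-pair (z Rᵢ×Rⱼ.+ w))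
              (mk⇔ (idempotent-resp ΠRing (Π.sym (pair-+ z w))) (idempotent-resp ΠRing (pair-+ z w)))

  char2⇒sumP4-free-Π : (∀ i → R._≈_ i (two (Rs i)) (R.0# i)) → SumP4-Free ΠRing
  char2⇒sumP4-free-Π two≈0 _ _ _ _ (ab , bc , _ , ¬ac , _) =
    ¬ac λ i → two≈0⇒idempotent-sum-trans (Rs i) (two≈0 i) (ab i) (bc i)

  chords⇒sumP4-free-Π : (j : Fin n) → HasSumChords (Rs j) → (∀ i → i ≢ j → R._≈_ i (two (Rs i)) (R.0# i))
                      → SumP4-Free ΠRing
  chords⇒sumP4-free-Π j chords two≈0 _ _ _ _ (ab , bc , cd , ¬ac , ¬bd , ¬ad) =
    [ (λ ac → ¬ac (glue ac λ i i≢j → trans₂ i i≢j (ab i) (bc i)))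
    , [ (λ bd → ¬bd (glue bd λ i i≢j → trans₂ i i≢j (bc i) (cd i)))
      , (λ ad → ¬ad (glue ad λ i i≢j → trans₂ i i≢j (trans₂ i i≢j (ab i) (bc i)) (cd i)))
      ] ] (chords (ab j) (bc j) (cd j))
    where
    trans₂ : ∀ i → i ≢ j → ∀ {x y z}
           → IsIdempotent (Rs i) (R._+_ i x y) → IsIdempotent (Rs i) (R._+_ i y z) → IsIdempotent (Rs i) (R._+_ i x z)
    trans₂ i i≢j = two≈0⇒idempotent-sum-trans (Rs i) (two≈0 i i≢j)
    glue : ∀ {u} → IsIdempotent (Rs j) (u j) → (∀ i → i ≢ j → IsIdempotent (Rs i) (u i))
         → IsIdempotent ΠRing u
    glue at-j elsewhere i with i ≟ j
    ... | yes ≡.refl = at-j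
    ... | no i≢j     = elsewhere i i≢j

-- Local rings

module _ {c ℓ} (S : CommutativeRing c ℓ) where
  open CommutativeRing S
  open import Algebra.Properties.Ring ring using (x[y-z]≈xy-xz)
  open import Relation.Binary.Reasoning.Setoid setoid
  open Identities S using (+-linear; *-linear; *-swap)

  private
    _⊆_ : Ideal S → Ideal S → Set (c ⊔ ℓ)
    _⊆_ = _⊆I_ S

  1∈⇒everything : (I : Ideal S) → mem I 1# → ∀ x → mem I x
  1∈⇒everything I 1∈I x = resp I (*-identityʳ x) (*-closed I x 1∈I)

  ⟨_⟩ : Carrier → Ideal S
  ⟨ y ⟩ = record
    { mem      = λ x → ∃ λ r → x ≈ y * r
    ; resp     = λ { x≈x′ (r , x≈yr) → r , trans (sym x≈x′) x≈yr }
    ; has-0    = 0# , sym (zeroʳ y)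
    ; +-closed = λ { (r , x≈yr) (r′ , x′≈yr′) →
                   r + r′ , trans (+-cong x≈yr x′≈yr′) (sym (distribˡ y r r′)) }
    ; *-closed = λ { s (r , x≈yr) → s * r , trans (*-congˡ x≈yr) (*-swap y s r) }
    }

  ∈⟨_⟩ : ∀ y → mem ⟨ y ⟩ y
  ∈⟨ y ⟩ = 1# , sym (*-identityʳ y)

  _+⟨_⟩ : Ideal S → Carrier → Ideal S
  I +⟨ y ⟩ = record
    { mem      = λ x → ∃₂ λ a r → mem I a × x ≈ a + y * r
    ; resp     = λ { x≈x′ (a , r , a∈I , x≈) → a , r , a∈I , trans (sym x≈x′) x≈ }
    ; has-0    = 0# , 0# , has-0 I , sym (trans (+-identityˡ _) (zeroʳ y))
    ; +-closed = λ { (a , r , a∈I , x≈) (a′ , r′ , a′∈I , x′≈) →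
                   a + a′ , r + r′ , +-closed I a∈I a′∈I , trans (+-cong x≈ x′≈) (+-linear y a r a′ r′) }
    ; *-closed = λ { s (a , r , a∈I , x≈) →
                   s * a , s * r , *-closed I s a∈I , trans (*-congˡ x≈) (*-linear y s a r) }
    }

  ⊆+⟨⟩ : ∀ I y → I ⊆ (I +⟨ y ⟩)
  ⊆+⟨⟩ I y x x∈I = x , 0# , x∈I , sym (trans (+-congˡ (zeroʳ y)) (+-identityʳ x))

  ∈+⟨⟩ : ∀ I y → mem (I +⟨ y ⟩) y
  ∈+⟨⟩ I y = 0# , 1# , has-0 I , sym (trans (+-identityˡ _) (*-identityʳ y))

  +⟨⟩-least : ∀ I J {y} → I ⊆ J → mem J y → (I +⟨ y ⟩) ⊆ J
  +⟨⟩-least I J {y} I⊆J y∈J x (a , r , a∈I , x≈) =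
    resp J (sym x≈) (+-closed J (I⊆J a a∈I) (resp J (*-comm r y) (*-closed J r y∈J)))

  -- Maximality of M, applied to the ideal M ∪ {x | P}, decides P.
  maximal⇒dec : (M : Ideal S) → IsMaximal S M → (P : Set (c ⊔ ℓ)) → Dec P
  maximal⇒dec M (M-proper , M-maximal) P with M-maximal M∪P (λ _ → inj₁)
    where
    M∪P : Ideal S
    M∪P = record
      { mem      = λ x → mem M x ⊎ P
      ; resp     = λ x≈y → map₁ (resp M x≈y)
      ; has-0    = inj₁ (has-0 M)
      ; +-closed = λ { (inj₁ x∈M) (inj₁ y∈M) → inj₁ (+-closed M x∈M y∈M)
                     ; (inj₂ p) _ → inj₂ p
                     ; _ (inj₂ p) → inj₂ p }
      ; *-closed = λ r → map₁ (*-closed M r)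
      }
  ... | inj₁ (M∪P⊆M , _) = no λ p → M-proper λ x → M∪P⊆M x (inj₂ p)
  ... | inj₂ M∪P-full    = [ (λ 1∈M → ⊥-elim (M-proper (1∈⇒everything M 1∈M))) , yes ] (M∪P-full 1#)

  local⇒dec : IsLocal S → (P : Set ℓ) → Dec P
  local⇒dec (M , M-maximal , _) P = map′ lower lift (maximal⇒dec M M-maximal (Lift (c ⊔ ℓ) P))

  local⇒1≉0 : IsLocal S → ¬ 1# ≈ 0#
  local⇒1≉0 (M , (M-proper , _) , _) 1≈0 = M-proper (1∈⇒everything M (resp M (sym 1≈0) (has-0 M)))

  module _ (dec : (P : Set (c ⊔ ℓ)) → Dec P) {k} (enum : Surjection (≡.setoid (Fin k)) setoid) where
    open Surjection enum using (strictlySurjective) renaming (to to element)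

    stable : {P : Set (c ⊔ ℓ)} → ¬ ¬ P → P
    stable = decidable-stable (dec _)

    trace : Ideal S → Subset k
    trace I = tabulate λ t → isYes (dec (mem I (element t)))

    ∈-trace⇔ : ∀ I t → t ∈ trace I ⇔ mem I (element t)
    ∈-trace⇔ I t = mk⇔
      (λ t∈ → toWitness {a? = dec _}
                (Equivalence.from T-≡ (≡.trans (≡.sym (lookup∘tabulate _ t)) ([]=⇒lookup t∈))))
      (λ t∈I → lookup⇒[]= t _
                 (≡.trans (lookup∘tabulate _ t) (≡.trans (isYes≗does _) (dec-true (dec _) t∈I))))

    trace-⊂ : ∀ I J {y} → I ⊆ J → mem J y → ¬ mem I y → trace I ⊂ trace J
    trace-⊂ I J {y} I⊆J y∈J y∉I =
        (λ {t} t∈I → Equivalence.from (∈-trace⇔ J t) (I⊆J _ (Equivalence.to (∈-trace⇔ I t) t∈I)))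
      , t , Equivalence.from (∈-trace⇔ J t) (resp J (sym t≈y) y∈J)
      , λ t∈I → y∉I (resp I t≈y (Equivalence.to (∈-trace⇔ I t) t∈I))
      where
      t = proj₁ (strictlySurjective y)
      t≈y = proj₂ (strictlySurjective y)

    outside : Ideal S → ℕ
    outside I = k ∸ ∣ trace I ∣

    outside-+⟨⟩ : ∀ I {y} → ¬ mem I y → outside (I +⟨ y ⟩) < outside I
    outside-+⟨⟩ I {y} y∉I =
      ∸-monoʳ-< (p⊂q⇒∣p∣<∣q∣ (trace-⊂ I (I +⟨ y ⟩) (⊆+⟨⟩ I y) (∈+⟨⟩ I y) y∉I))
                (∣p∣≤n (trace (I +⟨ y ⟩)))

    Extendable : Ideal S → Set (c ⊔ ℓ)
    Extendable I = ∃ λ y → ¬ mem I y × Proper S (I +⟨ y ⟩)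

    unextendable⇒maximal : ∀ I → Proper S I → ¬ Extendable I → IsMaximal S I
    unextendable⇒maximal I I-proper unextendable = I-proper , maximal
      where
      maximal : ∀ J → I ⊆ J → _≐I_ S J I ⊎ (∀ x → mem J x)
      maximal J I⊆J with dec (∃ λ y → mem J y × ¬ mem I y)
      ... | yes (y , y∈J , y∉I) = inj₂ λ x →
              +⟨⟩-least I J I⊆J y∈J x (stable (λ ¬full → unextendable (y , y∉I , ¬full)) x)
      ... | no J⊆I = inj₁ ((λ x x∈J → stable λ x∉I → J⊆I (x , x∈J , x∉I)) , I⊆J)

    proper⇒⊆maximal : ∀ I → Proper S I → ∃ λ N → IsMaximal S N × I ⊆ N
    proper⇒⊆maximal I = go _ I ≤-refl
      where
      go : ∀ m I → outside I ≤ m → Proper S I → ∃ λ N → IsMaximal S N × I ⊆ N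
      go zero I bound I-proper =
        I , unextendable⇒maximal I I-proper (λ (_ , y∉I , _) → n≮0 (≤-trans (outside-+⟨⟩ I y∉I) bound))
          , λ _ → id
      go (suc m) I bound I-proper with dec (Extendable I)
      ... | no unextendable = I , unextendable⇒maximal I I-proper unextendable , λ _ → id
      ... | yes (y , y∉I , I+y-proper) =
        let N , N-maximal , I+y⊆N = go m (I +⟨ y ⟩) (≤-pred (≤-trans (outside-+⟨⟩ I y∉I) bound)) I+y-proper
        in N , N-maximal , λ x → I+y⊆N x ∘ ⊆+⟨⟩ I y x

  1≈a*r⇒b≈b*a*r : ∀ {a r} b → 1# ≈ a * r → b ≈ (b * a) * r
  1≈a*r⇒b≈b*a*r {a} {r} b 1≈ar = begin
    b            ≈⟨ *-identityʳ b ⟨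
    b * 1#       ≈⟨ *-congˡ 1≈ar ⟩
    b * (a * r)  ≈⟨ *-assoc b a r ⟨
    (b * a) * r  ∎

  idempotent⇒e*[1-e]≈0 : ∀ {e} → IsIdempotent S e → e * (1# - e) ≈ 0#
  idempotent⇒e*[1-e]≈0 {e} ee≈e = begin
    e * (1# - e)    ≈⟨ x[y-z]≈xy-xz e 1# e ⟩
    e * 1# - e * e  ≈⟨ +-cong (*-identityʳ e) (-‿cong ee≈e) ⟩
    e - e           ≈⟨ -‿inverseʳ e ⟩
    0#              ∎

  e+[1-e]≈1 : ∀ e → e + (1# - e) ≈ 1#
  e+[1-e]≈1 e = begin
    e + (1# - e)    ≈⟨ +-comm e (1# - e) ⟩
    (1# - e) + e    ≈⟨ +-assoc 1# (- e) e ⟩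
    1# + (- e + e)  ≈⟨ +-congˡ (-‿inverseˡ e) ⟩
    1# + 0#         ≈⟨ +-identityʳ 1# ⟩
    1#              ∎

  local⇒idempotent-trivial : IsLocal S → ∀ {k} → Surjection (≡.setoid (Fin k)) setoid
                           → ∀ {e} → IsIdempotent S e → e ≈ 0# ⊎ e ≈ 1#
  local⇒idempotent-trivial local@(M , M-maximal , M-unique) enum {e} ee≈e
    with local⇒dec local (e ≈ 0#) | local⇒dec local (e ≈ 1#)
  ... | yes e≈0 | _       = inj₁ e≈0
  ... | no _    | yes e≈1 = inj₂ e≈1
  ... | no e≉0  | no e≉1  = ⊥-elim (proj₁ M-maximal (1∈⇒everything M (resp M (e+[1-e]≈1 e)
    (+-closed M (nonunit∈M e ⟨e⟩-proper) (nonunit∈M (1# - e) ⟨1-e⟩-proper)))))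
    where
    nonunit∈M : ∀ x → Proper S ⟨ x ⟩ → mem M x
    nonunit∈M x ⟨x⟩-proper =
      let N , N-maximal , ⟨x⟩⊆N = proper⇒⊆maximal (maximal⇒dec M M-maximal) enum ⟨ x ⟩ ⟨x⟩-proper
      in proj₁ (M-unique N N-maximal) x (⟨x⟩⊆N x ∈⟨ x ⟩)

    ⟨e⟩-proper : Proper S ⟨ e ⟩
    ⟨e⟩-proper full = let r , 1≈er = full 1# in e≉1 (begin
      e            ≈⟨ 1≈a*r⇒b≈b*a*r e 1≈er ⟩
      (e * e) * r  ≈⟨ *-congʳ ee≈e ⟩
      e * r        ≈⟨ 1≈er ⟨
      1#           ∎)

    ⟨1-e⟩-proper : Proper S ⟨ 1# - e ⟩
    ⟨1-e⟩-proper full = let r , 1≈[1-e]r = full 1# in e≉0 (begin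
      e                   ≈⟨ 1≈a*r⇒b≈b*a*r e 1≈[1-e]r ⟩
      (e * (1# - e)) * r  ≈⟨ *-congʳ (idempotent⇒e*[1-e]≈0 ee≈e) ⟩
      0# * r              ≈⟨ zeroˡ r ⟩
      0#                  ∎)

-- The ring ℤ₃

module _ where
  open RawRing ℤ₃ using () renaming (_+_ to _+₃_; _*_ to _*₃_; -_ to -₃_; 0# to 0₃; 1# to 1₃)

  IsIdempotent₃ : Fin 3 → Set
  IsIdempotent₃ x = x *₃ x ≡ x

  ℤ₃-sum-chords : ∀ a b c d → IsIdempotent₃ (a +₃ b) → IsIdempotent₃ (b +₃ c) → IsIdempotent₃ (c +₃ d)
                → IsIdempotent₃ (a +₃ c) ⊎ IsIdempotent₃ (b +₃ d) ⊎ IsIdempotent₃ (a +₃ d)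
  ℤ₃-sum-chords = from-yes (all? λ a → all? λ b → all? λ c → all? λ d →
    idempotent? (a +₃ b) →-dec idempotent? (b +₃ c) →-dec idempotent? (c +₃ d) →-dec
    (idempotent? (a +₃ c) ⊎-dec idempotent? (b +₃ d) ⊎-dec idempotent? (a +₃ d)))
    where
    idempotent? : ∀ x → Dec (IsIdempotent₃ x)
    idempotent? x = x *₃ x ≟ x

  ℤ₃-inverseʳ : ∀ a → a +₃ -₃ a ≡ 0₃
  ℤ₃-inverseʳ = from-yes (all? λ a → a +₃ -₃ a ≟ 0₃)

  ℤ₃-difference : ∀ a b → a +₃ -₃ b ≡ 0₃ → a ≡ b
  ℤ₃-difference = from-yes (all? λ a → all? λ b → (a +₃ -₃ b ≟ 0₃) →-dec (a ≟ b))

  module _ {c ℓ} (S : CommutativeRing c ℓ) where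
    open CommutativeRing S
    open ≡.≡-Reasoning

    ≅ℤ₃⇒hasSumChords : rawRing ≅ʳ ℤ₃ → HasSumChords S
    ≅ℤ₃⇒hasSumChords (φ , φ-iso) {w} {x} {y} {z} wx xy yz =
      map from (map from from) (ℤ₃-sum-chords (φ w) (φ x) (φ y) (φ z) (to wx) (to xy) (to yz))
      where
      open IsRingIsomorphism φ-iso
      to : ∀ {u v} → IsIdempotent S (u + v) → IsIdempotent₃ (φ u +₃ φ v)
      to {u} {v} idem = begin
        (φ u +₃ φ v) *₃ (φ u +₃ φ v)  ≡⟨ ≡.cong₂ _*₃_ (+-homo u v) (+-homo u v) ⟨
        φ (u + v) *₃ φ (u + v)        ≡⟨ *-homo (u + v) (u + v) ⟨
        φ ((u + v) * (u + v))         ≡⟨ ⟦⟧-cong idem ⟩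
        φ (u + v)                     ≡⟨ +-homo u v ⟩
        φ u +₃ φ v                    ∎
      from : ∀ {u v} → IsIdempotent₃ (φ u +₃ φ v) → IsIdempotent S (u + v)
      from {u} {v} idem = injective (begin
        φ ((u + v) * (u + v))         ≡⟨ *-homo (u + v) (u + v) ⟩
        φ (u + v) *₃ φ (u + v)        ≡⟨ ≡.cong₂ _*₃_ (+-homo u v) (+-homo u v) ⟩
        (φ u +₃ φ v) *₃ (φ u +₃ φ v)  ≡⟨ idem ⟩
        φ u +₃ φ v                    ≡⟨ +-homo u v ⟨
        φ (u + v)                     ∎)

  module _ {c ℓ} (S : CommutativeRing c ℓ) where
    open CommutativeRing S
    open import Algebra.Properties.Semiring.Mult semiring
      using (×-homo-+; ×1-homo-*; ×-congʳ; ×-assoc-*) renaming (_×_ to _·_)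
    open import Algebra.Properties.Ring ring
      using ( +-inverseʳ-unique; +-inverseˡ-unique; +-identityʳ-unique; ⁻¹-anti-homo‿-; -‿anti-homo-+
            ; x∙y⁻¹≈ε⇒x≈y; -‿injective; -0#≈0#)
    open import Relation.Binary.Reasoning.Setoid setoid

    -x≈0⇒x≈0 : ∀ {x} → - x ≈ 0# → x ≈ 0#
    -x≈0⇒x≈0 -x≈0 = -‿injective (trans -x≈0 (sym -0#≈0#))

    x-y≈z⇒x≈z+y : ∀ {x y z} → x - y ≈ z → x ≈ z + y
    x-y≈z⇒x≈z+y {x} {y} {z} x-y≈z = begin
      x              ≈⟨ +-identityʳ x ⟨
      x + 0#         ≈⟨ +-congˡ (-‿inverseˡ y) ⟨
      x + (- y + y)  ≈⟨ +-assoc x (- y) y ⟨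
      (x - y) + y    ≈⟨ +-congʳ x-y≈z ⟩
      z + y          ∎

    module _ (three≈0 : 3 · 1# ≈ 0#) where

      x+x≈-x : ∀ x → x + x ≈ - x
      x+x≈-x x = +-inverseʳ-unique x (x + x) (begin
        x + (x + x)   ≈⟨ +-congˡ (+-congˡ (+-identityʳ x)) ⟨
        3 · x         ≈⟨ ×-congʳ 3 (*-identityˡ x) ⟨
        3 · (1# * x)  ≈⟨ ×-assoc-* 3 1# x ⟨
        3 · 1# * x    ≈⟨ *-congʳ three≈0 ⟩
        0# * x        ≈⟨ zeroˡ x ⟩
        0#            ∎)

      x+[1+x]≈1-x : ∀ x → x + (1# + x) ≈ 1# - x
      x+[1+x]≈1-x x = begin
        x + (1# + x)  ≈⟨ +-comm x (1# + x) ⟩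
        (1# + x) + x  ≈⟨ +-assoc 1# x x ⟩
        1# + (x + x)  ≈⟨ +-congˡ (x+x≈-x x) ⟩
        1# - x        ∎

      -x-[1+x]≈x-1 : ∀ x → - x - (1# + x) ≈ x - 1#
      -x-[1+x]≈x-1 x = begin
        - x - (1# + x)    ≈⟨ -‿anti-homo-+ (1# + x) x ⟨
        - ((1# + x) + x)  ≈⟨ -‿cong (trans (+-comm (1# + x) x) (x+[1+x]≈1-x x)) ⟩
        - (1# - x)        ≈⟨ ⁻¹-anti-homo‿- 1# x ⟩
        x - 1#            ∎

      ×1-mod3 : ∀ m → toℕ (m mod 3) · 1# ≈ m · 1#
      ×1-mod3 m = begin
        r · 1#                    ≈⟨ +-identityʳ (r · 1#) ⟨
        r · 1# + 0#               ≈⟨ +-congˡ (zeroʳ (q · 1#)) ⟨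
        r · 1# + q · 1# * 0#      ≈⟨ +-congˡ (*-congˡ three≈0) ⟨
        r · 1# + q · 1# * 3 · 1#  ≈⟨ +-congˡ (×1-homo-* q 3) ⟨
        r · 1# + (q ℕ.* 3) · 1#   ≈⟨ ×-homo-+ 1# r (q ℕ.* 3) ⟨
        (r ℕ.+ q ℕ.* 3) · 1#      ≡⟨ ≡.cong (_· 1#) (DivMod.property (m divMod 3)) ⟨
        m · 1#                    ∎
        where
        r = toℕ (m mod 3)
        q = m / 3

      ι : Fin 3 → Carrier
      ι t = toℕ t · 1#

      ι-+ : ∀ a b → ι (a +₃ b) ≈ ι a + ι b
      ι-+ a b = trans (×1-mod3 (toℕ a ℕ.+ toℕ b)) (×-homo-+ 1# (toℕ a) (toℕ b))

      ι-* : ∀ a b → ι (a *₃ b) ≈ ι a * ι b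
      ι-* a b = trans (×1-mod3 (toℕ a ℕ.* toℕ b)) (×1-homo-* (toℕ a) (toℕ b))

      ι-‿ : ∀ a → ι (-₃ a) ≈ - ι a
      ι-‿ a = +-inverseʳ-unique (ι a) (ι (-₃ a)) (begin
        ι a + ι (-₃ a)  ≈⟨ ι-+ a (-₃ a) ⟨
        ι (a +₃ -₃ a)   ≡⟨ ≡.cong ι (ℤ₃-inverseʳ a) ⟩
        0#              ∎)

      module _ (two≉0 : ¬ two S ≈ 0#) where

        ι-kernel : ∀ u → ι u ≈ 0# → u ≡ 0₃
        ι-kernel 0F _   = ≡.refl
        ι-kernel 1F ι≈0 = ⊥-elim (two≉0 (trans (+-cong 1≈0 1≈0) (+-identityʳ 0#)))
          where 1≈0 = trans (sym (+-identityʳ 1#)) ι≈0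
        ι-kernel 2F ι≈0 = ⊥-elim (two≉0 (trans (+-congˡ (sym (+-identityʳ 1#))) ι≈0))

        ι-injective : ∀ a b → ι a ≈ ι b → a ≡ b
        ι-injective a b ιa≈ιb = ℤ₃-difference a b (ι-kernel (a +₃ -₃ b) (begin
          ι (a +₃ -₃ b)   ≈⟨ ι-+ a (-₃ b) ⟩
          ι a + ι (-₃ b)  ≈⟨ +-cong ιa≈ιb (ι-‿ b) ⟩
          ι b - ι b       ≈⟨ -‿inverseʳ (ι b) ⟩
          0#              ∎))

        module _ (trichotomy : ∀ x → x ≈ 0# ⊎ x ≈ 1# ⊎ x ≈ - 1#) where

          ι-surjective : ∀ x → ∃ λ t → ι t ≈ x
          ι-surjective x with trichotomy x
          ... | inj₁ x≈0         = 0F , sym x≈0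
          ... | inj₂ (inj₁ x≈1)  = 1F , trans (+-identityʳ 1#) (sym x≈1)
          ... | inj₂ (inj₂ x≈-1) =
            2F , trans (+-inverseˡ-unique (ι 2F) 1# (trans (+-comm _ 1#) three≈0)) (sym x≈-1)

          κ : Carrier → Fin 3
          κ x = proj₁ (ι-surjective x)

          ικ : ∀ x → x ≈ ι (κ x)
          ικ x = sym (proj₂ (ι-surjective x))

          κ-unique : ∀ x t → x ≈ ι t → κ x ≡ t
          κ-unique x t x≈ιt = ι-injective (κ x) t (trans (sym (ικ x)) x≈ιt)

          trichotomy⇒≅ℤ₃ : rawRing ≅ʳ ℤ₃
          trichotomy⇒≅ℤ₃ = κ , record
            { isRingMonomorphism = record
              { isRingHomomorphism = record
                { isSemiringHomomorphism = record
                  { isNearSemiringHomomorphism = record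
                    { +-isMonoidHomomorphism = record
                      { isMagmaHomomorphism = record
                        { isRelHomomorphism = record
                          { cong = λ {x} {y} x≈y → κ-unique x (κ y) (trans x≈y (ικ y)) }
                        ; homo = λ x y → κ-unique (x + y) _ (trans (+-cong (ικ x) (ικ y)) (sym (ι-+ (κ x) (κ y)))) }
                      ; ε-homo = κ-unique 0# 0₃ refl }
                    ; *-homo = λ x y → κ-unique (x * y) _ (trans (*-cong (ικ x) (ικ y)) (sym (ι-* (κ x) (κ y)))) }
                  ; 1#-homo = κ-unique 1# 1₃ (sym (+-identityʳ 1#)) }
                ; -‿homo = λ x → κ-unique (- x) _ (trans (-‿cong (ικ x)) (sym (ι-‿ (κ x)))) }
              ; injective = λ {x} {y} κx≡κy → trans (ικ x) (trans (reflexive (≡.cong ι κx≡κy)) (sym (ικ y))) }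
            ; surjective = λ t → ι t , λ {x} → κ-unique x t }

    module _ (dec : (P : Set ℓ) → Dec P) (idempotent-trivial : ∀ {e} → IsIdempotent S e → e ≈ 0# ⊎ e ≈ 1#)
             (two≉0 : ¬ two S ≈ 0#) (free : SumP4-Free S) where

      ≈-1⇒¬idempotent : ∀ {x} → x ≈ - 1# → ¬ IsIdempotent S x
      ≈-1⇒¬idempotent x≈-1 = two≉0 ∘ idempotent[-1]⇒two≈0 S ∘ idempotent-resp S x≈-1

      ≈two⇒¬idempotent : ∀ {x} → x ≈ two S → ¬ IsIdempotent S x
      ≈two⇒¬idempotent x≈2 = two≉0 ∘ idempotent[two]⇒two≈0 S ∘ idempotent-resp S x≈2

      three≈0 : 3 · 1# ≈ 0#
      three≈0 = decidable-stable (dec _) λ three≉0 → free 0# 1# (- 1#) (two S)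
        ( ≈1⇒idempotent S (+-identityˡ 1#)
        , ≈0⇒idempotent S (-‿inverseʳ 1#)
        , ≈1⇒idempotent S (-x+[1+x]≈1 S 1#)
        , ≈-1⇒¬idempotent (+-identityˡ (- 1#))
        , [ three≉0 ∘ trans (+-congˡ (+-congˡ (+-identityʳ 1#))) , two≉0 ∘ +-identityʳ-unique 1# (two S) ]
          ∘ idempotent-trivial
        , ≈two⇒¬idempotent (+-identityˡ (two S)) )

      idempotent[1-x]⇒x≈1⊎x≈0 : ∀ {x} → IsIdempotent S (1# - x) → x ≈ 1# ⊎ x ≈ 0#
      idempotent[1-x]⇒x≈1⊎x≈0 {x} =
        map (sym ∘ x∙y⁻¹≈ε⇒x≈y 1# x) (-x≈0⇒x≈0 ∘ +-identityʳ-unique 1# (- x)) ∘ idempotent-trivial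

      idempotent[x-1]⇒x≈1⊎x≈-1 : ∀ {x} → IsIdempotent S (x - 1#) → x ≈ 1# ⊎ x ≈ - 1#
      idempotent[x-1]⇒x≈1⊎x≈-1 {x} =
        map (x∙y⁻¹≈ε⇒x≈y x 1#) (λ x-1≈1 → trans (x-y≈z⇒x≈z+y x-1≈1) (x+x≈-x three≈0 1#))
        ∘ idempotent-trivial

      trichotomy : ∀ x → x ≈ 0# ⊎ x ≈ 1# ⊎ x ≈ - 1#
      trichotomy x with dec (x ≈ 0#) | dec (x ≈ 1#) | dec (x ≈ - 1#)
      ... | yes x≈0 | _       | _        = inj₁ x≈0
      ... | no _    | yes x≈1 | _        = inj₂ (inj₁ x≈1)
      ... | no _    | no _    | yes x≈-1 = inj₂ (inj₂ x≈-1)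
      ... | no x≉0  | no x≉1  | no x≉-1  = ⊥-elim (free x (- x) (1# + x) (- (1# + x))
        ( ≈0⇒idempotent S (-‿inverseʳ x)
        , ≈1⇒idempotent S (-x+[1+x]≈1 S x)
        , ≈0⇒idempotent S (-‿inverseʳ (1# + x))
        , [ x≉1 , x≉0 ] ∘ idempotent[1-x]⇒x≈1⊎x≈0 ∘ idempotent-resp S (x+[1+x]≈1-x three≈0 x)
        , [ x≉1 , x≉-1 ] ∘ idempotent[x-1]⇒x≈1⊎x≈-1 ∘ idempotent-resp S (-x-[1+x]≈x-1 three≈0 x)
        , ≈-1⇒¬idempotent (x-[1+x]≈-1 S x) ))

      sumP4-free⇒≅ℤ₃ : rawRing ≅ʳ ℤ₃
      sumP4-free⇒≅ℤ₃ = trichotomy⇒≅ℤ₃ three≈0 two≉0 trichotomy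

module _ {c ℓ} (S : CommutativeRing c ℓ) where
  open CommutativeRing S

  hasChar2⇒two≈0 : HasChar S 2 → two S ≈ 0#
  hasChar2⇒two≈0 (_ , 1+[1+0]≈0 , _) = trans (+-congˡ (sym (+-identityʳ 1#))) 1+[1+0]≈0

  two≈0⇒hasChar2 : ¬ 1# ≈ 0# → two S ≈ 0# → HasChar S 2
  two≈0⇒hasChar2 1≉0 two≈0 = s≤s z≤n , trans (+-congˡ (+-identityʳ 1#)) two≈0 , λ where
    (suc zero) _ _ 1+0≈0 → 1≉0 (trans (sym (+-identityʳ 1#)) 1+0≈0)
    (suc (suc _)) _ (s≤s (s≤s ()))

CographFactors : ∀ {c ℓ} {n} → (Fin n → CommutativeRing c ℓ) → Set (c ⊔ ℓ)
CographFactors {n = n} Rs =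
  (∀ i → HasChar (Rs i) 2)
  ⊎ (Σ (Fin n) λ j → (CommutativeRing.rawRing (Rs j) ≅ʳ ℤ₃) × (∀ i → ¬ (i ≡ j) → HasChar (Rs i) 2))

module _ {c ℓ} {n} (Rs : Fin n → CommutativeRing c ℓ) where
  private
    module R (i : Fin n) = CommutativeRing (Rs i)

  cographFactors⇒sumP4-free-Π : CographFactors Rs → SumP4-Free (ΠRing Rs)
  cographFactors⇒sumP4-free-Π (inj₁ char2) = char2⇒sumP4-free-Π Rs λ i → hasChar2⇒two≈0 (Rs i) (char2 i)
  cographFactors⇒sumP4-free-Π (inj₂ (j , Rⱼ≅ℤ₃ , char2)) =
    chords⇒sumP4-free-Π Rs j (≅ℤ₃⇒hasSumChords (Rs j) Rⱼ≅ℤ₃)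
      λ i i≢j → hasChar2⇒two≈0 (Rs i) (char2 i i≢j)

  module _ (local : ∀ i → IsLocal (Rs i))
           (enumeration : ∀ i → ∃ λ k → Surjection (≡.setoid (Fin k)) (CommutativeRing.setoid (Rs i)))
           (other : (j : Fin n) → ∃ λ i → i ≢ j) (free : SumP4-Free (ΠRing Rs)) where

    two≈0? : ∀ i → Dec (R._≈_ i (two (Rs i)) (R.0# i))
    two≈0? i = local⇒dec (Rs i) (local i) _

    two≈0-elsewhere : ∀ {i j} → i ≢ j → ¬ R._≈_ j (two (Rs j)) (R.0# j) → R._≈_ i (two (Rs i)) (R.0# i)
    two≈0-elsewhere {i} {j} i≢j two≉0 = decidable-stable (two≈0? i) λ two≉0ᵢ →
      two≉0⇒¬sumP4-free-× (Rs i) (Rs j) two≉0ᵢ two≉0 (sumP4-free-Π⇒sumP4-free-× Rs i≢j free)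

    two≉0⇒≅ℤ₃ : ∀ j → ¬ R._≈_ j (two (Rs j)) (R.0# j) → R.rawRing j ≅ʳ ℤ₃
    two≉0⇒≅ℤ₃ j two≉0 = sumP4-free⇒≅ℤ₃ (Rs j) (local⇒dec (Rs j) (local j))
      (local⇒idempotent-trivial (Rs j) (local j) (proj₂ (enumeration j))) two≉0
      (sumP4-free-×⇒sumP4-free₂ (Rs i) (Rs j) (sumP4-free-Π⇒sumP4-free-× Rs i≢j free))
      where
      i = proj₁ (other j)
      i≢j = proj₂ (other j)

    sumP4-free-Π⇒cographFactors : CographFactors Rs
    sumP4-free-Π⇒cographFactors with all? two≈0?
    ... | yes two≈0 = inj₁ λ i → two≈0⇒hasChar2 (Rs i) (local⇒1≉0 (Rs i) (local i)) (two≈0 i)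
    ... | no ¬two≈0 =
      let j , two≉0 = ¬∀⟶∃¬ n _ two≈0? ¬two≈0
      in inj₂ (j , two≉0⇒≅ℤ₃ j two≉0 , λ i i≢j →
           two≈0⇒hasChar2 (Rs i) (local⇒1≉0 (Rs i) (local i)) (two≈0-elsewhere i≢j two≉0))

theorem4p3 : ∀ {c ℓ c′ ℓ′} (R : CommutativeRing c ℓ) → Finite R
    → (n : ℕ) → 2 ≤ n
    → (Rs : Fin n → CommutativeRing c′ ℓ′) → (∀ i → IsLocal (Rs i))
    → CommutativeRing.rawRing R ≅ʳ ΠRaw n Rs
    → IdempotentGraphIsCograph R
      ⇔ ((∀ i → HasChar (Rs i) 2)
         ⊎ (Σ (Fin n) λ j → (CommutativeRing.rawRing (Rs j) ≅ʳ ℤ₃)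
              × (∀ i → ¬ (i ≡ j) → HasChar (Rs i) 2)))
theorem4p3 R (k , Fin↔R) (suc (suc m)) (s≤s (s≤s z≤n)) Rs local R≅Π =
  ⇔-trans (⇔-trans (cograph⇔sumP4-free R) (≅ʳ⇒sumP4-free⇔ R (ΠRing Rs) R≅Π))
          (mk⇔ (sumP4-free-Π⇒cographFactors Rs local enumeration other) (cographFactors⇒sumP4-free-Π Rs))
  where
  enumeration : ∀ i → ∃ λ k → Surjection (≡.setoid (Fin k)) (CommutativeRing.setoid (Rs i))
  enumeration i = k , Compose.surjection
    (Compose.surjection (Inverse⇒Surjection Fin↔R) (≅ʳ⇒surjection R (ΠRing Rs) R≅Π))
    (coordinate-surjection Rs i)
  other : ∀ j → ∃ λ i → i ≢ j
  other j = punchIn j 0F , punchInᵢ≢i j 0F
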